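{- For all finite multisets $\Gamma,\Delta$ of $\mathcal{L}_{A_m}^{\Box}$-formulas: the sequent $\Gamma\Rightarrow\Delta$ is derivable in $GK(A_m)$ if and only if $\mathcal{I}(\Gamma\Rightarrow\Delta)$ is derivable in the axiom system $K(A_m)$.
   Context: $\mathcal{L}_{A_m}^{\Box}$-formulas are built from a countably infinite set $\mathrm{Var}$ of variables using binary $\to$ and unary $\Box$. Fix $p_0\in\mathrm{Var}$; abbreviations $\overline0:=p_0\to p_0$, $\neg\varphi:=\varphi\to\overline0$, $\varphi\&\psi:=\neg\varphi\to\psi$, $0\varphi:=\overline0$, $(n+1)\varphi:=\varphi\&(n\varphi)$. Axiom system $K(A_m)$: axiom schemas (B) $(\varphi\to\psi)\to((\psi\to\chi)\to(\varphi\to\chi))$; (C) $(\varphi\to(\psi\to\chi))\to(\psi\to(\varphi\to\chi))$; (I) $\varphi\to\varphi$; (A) $((\varphi\to\psi)\to\psi)\to\varphi$; (K) $\Box(\varphi\to\psi)\to(\Box\varphi\to\Box\psi)$; (D$_n$) $\Box(n\varphi)\to n\Box\varphi$ ($n\ge2$); rules (mp) $\varphi,\ \varphi\to\psi\,/\,\psi$; (nec) $\varphi\,/\,\Box\varphi$; (con$_n$) $n\varphi\,/\,\varphi$ ($n\ge2$). Sequents: a sequent $\Gamma\Rightarrow\Delta$ is an ordered pair of finite multisets of formulas; $\Gamma,\Delta$ denotes multiset union, $n\Gamma$ the union of $n$ copies of $\Gamma$, $n[\varphi]$ the multiset of $n$ copies of $\varphi$, $\Box\Gamma=[\Box\varphi:\varphi\in\Gamma]$.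 $\mathcal{I}(\varphi_1,\dots,\varphi_n\Rightarrow\psi_1,\dots,\psi_m):=(\varphi_1\&\dots\&\varphi_n)\to(\psi_1\&\dots\&\psi_m)$, an empty $\&$-conjunction being $\overline0$. The sequent calculus $GK(A_m)$ has rules: (ID) $\Delta\Rightarrow\Delta$ (no premises); (cut) from $\Gamma,\varphi\Rightarrow\Delta$ and $\Pi\Rightarrow\varphi,\Sigma$ infer $\Gamma,\Pi\Rightarrow\Sigma,\Delta$; (mix) from $\Gamma\Rightarrow\Delta$ and $\Pi\Rightarrow\Sigma$ infer $\Gamma,\Pi\Rightarrow\Sigma,\Delta$; (sc$_n$) ($n\ge2$) from $n\Gamma\Rightarrow n\Delta$ infer $\Gamma\Rightarrow\Delta$; ($\to\Rightarrow$) from $\Gamma,\psi\Rightarrow\varphi,\Delta$ infer $\Gamma,\varphi\to\psi\Rightarrow\Delta$; ($\Rightarrow\to$) from $\Gamma,\varphi\Rightarrow\psi,\Delta$ infer $\Gamma\Rightarrow\varphi\to\psi,\Delta$; ($\Box_n$) ($n\ge0$) from $\Gamma\Rightarrow n[\varphi]$ infer $\Box\Gamma\Rightarrow n[\Box\varphi]$. A derivation is a finite tree of sequents each node of which is obtained from its children by a rule. -}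

module Defs where

open import Data.Nat using (ℕ; zero; suc; _≤_)
open import Data.List using (List; []; _∷_; _++_; map; replicate; concat)
open import Data.List.Relation.Binary.Permutation.Propositional using (_↭_)

infixr 5 _⇒ᶠ_
data Formula : Set where
  var  : ℕ → Formula
  _⇒ᶠ_ : Formula → Formula → Formula
  □_   : Formula → Formula

p₀ : Formula
p₀ = var 0

𝟘 : Formula
𝟘 = p₀ ⇒ᶠ p₀

¬ᶠ_ : Formula → Formula
¬ᶠ φ = φ ⇒ᶠ 𝟘

infixr 6 _&_
_&_ : Formula → Formula → Formula
φ & ψ = (¬ᶠ φ) ⇒ᶠ ψ

times : ℕ → Formula → Formula
times zero    φ = 𝟘
times (suc n) φ = φ & times n φ

bigAnd : List Formula → Formula
bigAnd []           = 𝟘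
bigAnd (φ ∷ [])     = φ
bigAnd (φ ∷ ψ ∷ ρ)  = φ & bigAnd (ψ ∷ ρ)

data ⊢K : Formula → Set where
  axB  : ∀ φ ψ χ → ⊢K ((φ ⇒ᶠ ψ) ⇒ᶠ ((ψ ⇒ᶠ χ) ⇒ᶠ (φ ⇒ᶠ χ)))
  axC  : ∀ φ ψ χ → ⊢K ((φ ⇒ᶠ (ψ ⇒ᶠ χ)) ⇒ᶠ (ψ ⇒ᶠ (φ ⇒ᶠ χ)))
  axI  : ∀ φ → ⊢K (φ ⇒ᶠ φ)
  axA  : ∀ φ ψ → ⊢K (((φ ⇒ᶠ ψ) ⇒ᶠ ψ) ⇒ᶠ φ)
  axK  : ∀ φ ψ → ⊢K (□ (φ ⇒ᶠ ψ) ⇒ᶠ (□ φ ⇒ᶠ □ ψ))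
  axD  : ∀ n φ → 2 ≤ n → ⊢K (□ (times n φ) ⇒ᶠ times n (□ φ))
  mp   : ∀ {φ ψ} → ⊢K φ → ⊢K (φ ⇒ᶠ ψ) → ⊢K ψ
  nec  : ∀ {φ} → ⊢K φ → ⊢K (□ φ)
  con  : ∀ n {φ} → 2 ≤ n → ⊢K (times n φ) → ⊢K φ

-- Sequents Γ ⇒ Δ: pairs of finite multisets, represented by lists taken
-- up to permutation (structural rule `perm` in GK below).

copies : ℕ → List Formula → List Formula
copies n Γ = concat (replicate n Γ)

data GK : List Formula → List Formula → Set where
  perm  : ∀ {Γ Γ' Δ Δ'} → Γ ↭ Γ' → Δ ↭ Δ' → GK Γ Δ → GK Γ' Δ'
  ID    : ∀ Δ → GK Δ Δ
  cut   : ∀ {Γ Δ Π Σ φ} → GK (Γ ++ φ ∷ []) Δ → GK Π (φ ∷ Σ) → GK (Γ ++ Π) (Σ ++ Δ)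
  mix   : ∀ {Γ Δ Π Σ} → GK Γ Δ → GK Π Σ → GK (Γ ++ Π) (Σ ++ Δ)
  sc    : ∀ n {Γ Δ} → 2 ≤ n → GK (copies n Γ) (copies n Δ) → GK Γ Δ
  →L    : ∀ {Γ Δ φ ψ} → GK (Γ ++ ψ ∷ []) (φ ∷ Δ) → GK (Γ ++ (φ ⇒ᶠ ψ) ∷ []) Δ
  →R    : ∀ {Γ Δ φ ψ} → GK (Γ ++ φ ∷ []) (ψ ∷ Δ) → GK Γ ((φ ⇒ᶠ ψ) ∷ Δ)
  box   : ∀ n {Γ φ} → GK Γ (replicate n φ) → GK (map □_ Γ) (replicate n (□ φ))

ℐ : List Formula → List Formula → Formula
ℐ Γ Δ = bigAnd Γ ⇒ᶠ bigAnd Δ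

-- Modulo provable equivalence, formulas form an abelian group under &, with
-- unit 0̄ and inverse ¬, ordered by a ≼ b := ⊢ a → b (the Lindenbaum algebra of
-- A_m); moreover φ → ψ ≈ ¬φ & ψ. Reading a sequent Γ ⇒ Δ as the inequality
-- ⋀Γ ≼ ⋀Δ of &-products, every rule of GK(A_m) preserves validity: the logical
-- rules are group arithmetic, (□ₙ) follows from (K) and (Dₙ), and (scₙ) from
-- (conₙ) because n(a → b) ≈ na → nb. Conversely, every axiom and rule of
-- K(A_m) is derivable in GK(A_m), and the sequents Γ ⇒ [⋀Γ] and [⋀Δ] ⇒ Δ are
-- derivable, so ⊢ ⋀Γ → ⋀Δ yields Γ ⇒ Δ by cutting with whole multisets.
module Submission where

open import Defs
open import Data.Nat using (zero; suc; s≤s; z≤n)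
open import Data.Product using (_×_; _,_; proj₁; proj₂)
open import Data.List using (List; []; _∷_; _++_; [_]; map; replicate; foldr)
open import Data.List.Properties using (++-identityʳ)
open import Data.List.Relation.Binary.Permutation.Propositional
  using (_↭_; refl; prep; swap; trans; ↭-refl; ↭-sym; ↭-reflexive)
open import Data.List.Relation.Binary.Permutation.Propositional.Properties
  using (∷↭∷ʳ; ++-comm)
open import Algebra.Bundles using (AbelianGroup)
open import Relation.Binary.Bundles using (Preorder)
open import Relation.Binary.Structures using (IsEquivalence)
open import Relation.Binary.PropositionalEquality
  using (_≡_; cong; subst; subst₂; sym)
  renaming (refl to ≡-refl)
open import Function.Bundles using (_⇔_; mk⇔)

variable
  a a' b b' c : Formula
  φ ψ : Formula
  Γ Γ' Δ Δ' Θ : List Formula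

infix 4 _≼_ _≈_

_≼_ : Formula → Formula → Set
a ≼ b = ⊢K (a ⇒ᶠ b)

≼-refl : a ≼ a
≼-refl = axI _

≼-trans : a ≼ b → b ≼ c → a ≼ c
≼-trans {a} {b} {c} p q = mp q (mp p (axB a b c))

≼-exchange : a ≼ (b ⇒ᶠ c) → b ≼ (a ⇒ᶠ c)
≼-exchange p = mp p (axC _ _ _)

⇒-antitoneˡ : a' ≼ a → (a ⇒ᶠ b) ≼ (a' ⇒ᶠ b)
⇒-antitoneˡ {a'} {a} {b} p = mp p (axB a' a b)

⇒-monoʳ : b ≼ b' → (a ⇒ᶠ b) ≼ (a ⇒ᶠ b')
⇒-monoʳ {b} {b'} {a} p = mp p (≼-exchange (axB a b b'))

⇒⇒-intro : a ≼ ((a ⇒ᶠ b) ⇒ᶠ b)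
⇒⇒-intro {a} {b} = ≼-exchange (axI (a ⇒ᶠ b))

⇒⇒-elim : ((a ⇒ᶠ b) ⇒ᶠ b) ≼ a
⇒⇒-elim {a} {b} = axA a b

⇒-self-≼ : (a ⇒ᶠ a) ≼ (b ⇒ᶠ b)
⇒-self-≼ {a} {b} =
  ≼-trans (≼-exchange (axB (b ⇒ᶠ a) a a))
          (≼-trans (⇒-antitoneˡ ⇒⇒-intro) (⇒-monoʳ ⇒⇒-elim))

⊢⇒𝟘≼ : ⊢K a → 𝟘 ≼ a
⊢⇒𝟘≼ ⊢a = ≼-trans ⇒-self-≼ (mp ⊢a ⇒⇒-intro)

curry : (a & b) ≼ c → a ≼ (b ⇒ᶠ c)
curry {a} {b} p =
  ≼-exchange (≼-trans (≼-exchange (≼-trans (≼-trans ⇒⇒-intro (⇒-monoʳ ⇒-self-≼))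
                                            (axC (a ⇒ᶠ 𝟘) b b)))
                      (⇒-monoʳ p))

uncurry : a ≼ (b ⇒ᶠ c) → (a & b) ≼ c
uncurry {a} {b} {c} p =
  ≼-trans (⇒-monoʳ (≼-exchange p))
  (≼-trans (⇒-monoʳ (axB a c 𝟘))
  (≼-trans (axC _ _ _)
  (≼-trans (⇒-monoʳ ⇒-self-≼) ⇒⇒-elim)))

_≈_ : Formula → Formula → Set
a ≈ b = (a ≼ b) × (b ≼ a)

≈⇒≼ : a ≈ b → a ≼ b
≈⇒≼ = proj₁

≈-isEquivalence : IsEquivalence _≈_
≈-isEquivalence = record
  { refl  = ≼-refl , ≼-refl
  ; sym   = λ (p , q) → q , p
  ; trans = λ (p , q) (r , s) → ≼-trans p r , ≼-trans s q
  }

open IsEquivalence ≈-isEquivalence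
  using () renaming (refl to ≈-refl; sym to ≈-sym; trans to ≈-trans)

≼-resp-≈ : a ≈ a' → b ≈ b' → a ≼ b → a' ≼ b'
≼-resp-≈ (_ , a'≼a) (b≼b' , _) p = ≼-trans a'≼a (≼-trans p b≼b')

&-comm-≼ : (a & b) ≼ (b & a)
&-comm-≼ = uncurry (≼-exchange (curry ≼-refl))

&-comm : ∀ a b → (a & b) ≈ (b & a)
&-comm a b = &-comm-≼ , &-comm-≼

&-monoˡ : a ≼ a' → (a & b) ≼ (a' & b)
&-monoˡ p = uncurry (≼-trans p (curry ≼-refl))

&-monoʳ : b ≼ b' → (a & b) ≼ (a & b')
&-monoʳ p = ≼-trans &-comm-≼ (≼-trans (&-monoˡ p) &-comm-≼)

&-mono : a ≼ a' → b ≼ b' → (a & b) ≼ (a' & b')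
&-mono p q = ≼-trans (&-monoˡ p) (&-monoʳ q)

&-cong : a ≈ a' → b ≈ b' → (a & b) ≈ (a' & b')
&-cong (p , q) (r , s) = &-mono p r , &-mono q s

&-assoc-≼ : ((a & b) & c) ≼ (a & (b & c))
&-assoc-≼ {a} {b} {c} =
  uncurry (uncurry (≼-exchange (≼-trans (curry (≼-exchange (curry {a} {b & c} ≼-refl)))
                                        (axC c a (a & (b & c))))))

&-assoc : ∀ a b c → ((a & b) & c) ≈ (a & (b & c))
&-assoc a b c =
  &-assoc-≼ , ≼-trans &-comm-≼ (≼-trans &-assoc-≼ (≼-trans &-comm-≼ (≼-trans &-assoc-≼ &-comm-≼)))

𝟘⇒-≈ : (𝟘 ⇒ᶠ a) ≈ a
𝟘⇒-≈ {a} = ≼-trans (≼-exchange (≼-trans (axB a 𝟘 a) (⇒-monoʳ ⇒-self-≼))) ⇒⇒-elim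
         , ≼-exchange ⇒-self-≼

&-identityʳ : ∀ a → (a & 𝟘) ≈ a
&-identityʳ a = uncurry (proj₂ 𝟘⇒-≈) , ≼-trans (curry ≼-refl) (proj₁ 𝟘⇒-≈)

-- a & ¬a is literally ¬a → ¬a.
&-inverseʳ : ∀ a → (a & ¬ᶠ a) ≈ 𝟘
&-inverseʳ a = uncurry ⇒⇒-intro , ⇒-self-≼

¬-cong : a ≈ b → ¬ᶠ a ≈ ¬ᶠ b
¬-cong (p , q) = ⇒-antitoneˡ q , ⇒-antitoneˡ p

⇒≈¬& : (a ⇒ᶠ b) ≈ (¬ᶠ a & b)
⇒≈¬& = ⇒-antitoneˡ ⇒⇒-elim , ⇒-antitoneˡ ⇒⇒-intro

&-abelianGroup : AbelianGroup _ _
&-abelianGroup = record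
  { Carrier = Formula ; _≈_ = _≈_ ; _∙_ = _&_ ; ε = 𝟘 ; _⁻¹ = ¬ᶠ_
  ; isAbelianGroup = record
    { isGroup = record
      { isMonoid = record
        { isSemigroup = record
          { isMagma = record { isEquivalence = ≈-isEquivalence ; ∙-cong = &-cong }
          ; assoc = &-assoc }
        ; identity = (λ a → ≈-trans (&-comm 𝟘 a) (&-identityʳ a)) , &-identityʳ }
      ; inverse = (λ a → ≈-trans (&-comm (¬ᶠ a) a) (&-inverseʳ a)) , &-inverseʳ
      ; ⁻¹-cong = ¬-cong }
    ; comm = &-comm } }

open AbelianGroup &-abelianGroup using (commutativeSemigroup)
open import Algebra.Properties.AbelianGroup &-abelianGroup
  using (\\-leftDividesʳ; ⁻¹-∙-comm)
open import Algebra.Properties.CommutativeSemigroup commutativeSemigroup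
  using (interchange; x∙yz≈y∙xz)

≼-preorder : Preorder _ _ _
≼-preorder = record
  { Carrier = Formula ; _≈_ = _≈_ ; _≲_ = _≼_
  ; isPreorder = record
    { isEquivalence = ≈-isEquivalence ; reflexive = ≈⇒≼ ; trans = ≼-trans } }

open import Relation.Binary.Reasoning.Preorder ≼-preorder

times-⇒ : ∀ n → times n (a ⇒ᶠ b) ≈ (times n a ⇒ᶠ times n b)
times-⇒ zero = ⇒-self-≼ , ⇒-self-≼
times-⇒ {a} {b} (suc n) = begin-equality
  (a ⇒ᶠ b) & times n (a ⇒ᶠ b)                    ≈⟨ &-cong ⇒≈¬& (times-⇒ n) ⟩
  (¬ᶠ a & b) & (times n a ⇒ᶠ times n b)         ≈⟨ &-cong ≈-refl ⇒≈¬& ⟩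
  (¬ᶠ a & b) & (¬ᶠ times n a & times n b)      ≈⟨ interchange _ _ _ _ ⟩
  (¬ᶠ a & ¬ᶠ times n a) & (b & times n b)      ≈⟨ &-cong (⁻¹-∙-comm _ _) ≈-refl ⟩
  ¬ᶠ (a & times n a) & (b & times n b)         ≈⟨ ⇒≈¬& ⟨
  times (suc n) a ⇒ᶠ times (suc n) b           ∎

□-mono : a ≼ b → □ a ≼ □ b
□-mono {a} {b} p = mp (nec p) (axK a b)

□-&-≼ : (□ a & □ b) ≼ □ (a & b)
□-&-≼ {a} {b} = uncurry (≼-trans (□-mono (curry ≼-refl)) (axK b (a & b)))

□-𝟘 : 𝟘 ≼ □ 𝟘
□-𝟘 = ⊢⇒𝟘≼ (nec (axI p₀))

□-times : ∀ n → □ (times n a) ≼ times n (□ a)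
□-times zero = ≼-trans (axK p₀ p₀) ⇒-self-≼
□-times {a} (suc zero) = ≼-trans (□-mono (≈⇒≼ (&-identityʳ a))) (proj₂ (&-identityʳ (□ a)))
□-times {a} (suc (suc n)) = axD (suc (suc n)) a (s≤s (s≤s z≤n))

-- bigAnd without its singleton clause, so that ⋀ (replicate n φ) reduces like times n φ.
⋀ : List Formula → Formula
⋀ = foldr _&_ 𝟘

bigAnd≈⋀ : ∀ Γ → bigAnd Γ ≈ ⋀ Γ
bigAnd≈⋀ [] = ≈-refl
bigAnd≈⋀ (φ ∷ []) = ≈-sym (&-identityʳ φ)
bigAnd≈⋀ (φ ∷ ψ ∷ Γ) = &-cong ≈-refl (bigAnd≈⋀ (ψ ∷ Γ))

⋀-++ : ∀ Γ Δ → ⋀ (Γ ++ Δ) ≈ (⋀ Γ & ⋀ Δ)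
⋀-++ [] Δ = ≈-sym (≈-trans (&-comm 𝟘 (⋀ Δ)) (&-identityʳ (⋀ Δ)))
⋀-++ (φ ∷ Γ) Δ = ≈-trans (&-cong ≈-refl (⋀-++ Γ Δ)) (≈-sym (&-assoc φ (⋀ Γ) (⋀ Δ)))

⋀-∷ʳ : ∀ Γ φ → ⋀ (Γ ++ [ φ ]) ≈ (⋀ Γ & φ)
⋀-∷ʳ Γ φ = ≈-trans (⋀-++ Γ [ φ ]) (&-cong ≈-refl (&-identityʳ φ))

⋀-↭ : Γ ↭ Δ → ⋀ Γ ≈ ⋀ Δ
⋀-↭ refl = ≈-refl
⋀-↭ (prep φ p) = &-cong ≈-refl (⋀-↭ p)
⋀-↭ (swap φ ψ p) = ≈-trans (&-cong ≈-refl (&-cong ≈-refl (⋀-↭ p))) (x∙yz≈y∙xz φ ψ _)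
⋀-↭ (trans p q) = ≈-trans (⋀-↭ p) (⋀-↭ q)

⋀-replicate : ∀ n φ → ⋀ (replicate n φ) ≡ times n φ
⋀-replicate zero φ = ≡-refl
⋀-replicate (suc n) φ = cong (φ &_) (⋀-replicate n φ)

⋀-copies : ∀ n Γ → ⋀ (copies n Γ) ≈ times n (⋀ Γ)
⋀-copies zero Γ = ≈-refl
⋀-copies (suc n) Γ = ≈-trans (⋀-++ Γ (copies n Γ)) (&-cong ≈-refl (⋀-copies n Γ))

⋀-□ : ∀ Γ → ⋀ (map □_ Γ) ≼ □ (⋀ Γ)
⋀-□ [] = □-𝟘
⋀-□ (φ ∷ Γ) = ≼-trans (&-monoʳ (⋀-□ Γ)) □-&-≼

sound : GK Γ Δ → ⋀ Γ ≼ ⋀ Δ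
sound (perm p q d) = ≼-resp-≈ (⋀-↭ p) (⋀-↭ q) (sound d)
sound (ID Δ) = ≼-refl
sound (cut {Γ} {Δ} {Π} {Σ} {φ} d e) = begin
  ⋀ (Γ ++ Π)             ≈⟨ ⋀-++ Γ Π ⟩
  ⋀ Γ & ⋀ Π              ≲⟨ &-monoʳ (sound e) ⟩
  ⋀ Γ & (φ & ⋀ Σ)        ≈⟨ &-assoc (⋀ Γ) φ (⋀ Σ) ⟨
  (⋀ Γ & φ) & ⋀ Σ        ≈⟨ &-cong (⋀-∷ʳ Γ φ) ≈-refl ⟨
  ⋀ (Γ ++ [ φ ]) & ⋀ Σ   ≲⟨ &-monoˡ (sound d) ⟩
  ⋀ Δ & ⋀ Σ              ≈⟨ &-comm (⋀ Δ) (⋀ Σ) ⟩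
  ⋀ Σ & ⋀ Δ              ≈⟨ ⋀-++ Σ Δ ⟨
  ⋀ (Σ ++ Δ)             ∎
sound (mix {Γ} {Δ} {Π} {Σ} d e) = begin
  ⋀ (Γ ++ Π)             ≈⟨ ⋀-++ Γ Π ⟩
  ⋀ Γ & ⋀ Π              ≲⟨ &-mono (sound d) (sound e) ⟩
  ⋀ Δ & ⋀ Σ              ≈⟨ &-comm (⋀ Δ) (⋀ Σ) ⟩
  ⋀ Σ & ⋀ Δ              ≈⟨ ⋀-++ Σ Δ ⟨
  ⋀ (Σ ++ Δ)             ∎
sound (sc n {Γ} {Δ} n≥2 d) = con n n≥2 (mp nΓ≼nΔ (proj₂ (times-⇒ n)))
  where
  nΓ≼nΔ : times n (⋀ Γ) ≼ times n (⋀ Δ)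
  nΓ≼nΔ = begin
    times n (⋀ Γ)        ≈⟨ ⋀-copies n Γ ⟨
    ⋀ (copies n Γ)       ≲⟨ sound d ⟩
    ⋀ (copies n Δ)       ≈⟨ ⋀-copies n Δ ⟩
    times n (⋀ Δ)        ∎
sound (→L {Γ} {Δ} {φ} {ψ} d) = begin
  ⋀ (Γ ++ [ φ ⇒ᶠ ψ ])    ≈⟨ ⋀-∷ʳ Γ (φ ⇒ᶠ ψ) ⟩
  ⋀ Γ & (φ ⇒ᶠ ψ)         ≈⟨ &-cong ≈-refl ⇒≈¬& ⟩
  ⋀ Γ & (¬ᶠ φ & ψ)       ≈⟨ x∙yz≈y∙xz (⋀ Γ) (¬ᶠ φ) ψ ⟩
  ¬ᶠ φ & (⋀ Γ & ψ)       ≈⟨ &-cong ≈-refl (⋀-∷ʳ Γ ψ) ⟨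
  ¬ᶠ φ & ⋀ (Γ ++ [ ψ ])  ≲⟨ &-monoʳ (sound d) ⟩
  ¬ᶠ φ & (φ & ⋀ Δ)       ≈⟨ \\-leftDividesʳ φ (⋀ Δ) ⟩
  ⋀ Δ                    ∎
sound (→R {Γ} {Δ} {φ} {ψ} d) = begin
  ⋀ Γ                    ≈⟨ \\-leftDividesʳ φ (⋀ Γ) ⟨
  ¬ᶠ φ & (φ & ⋀ Γ)       ≈⟨ &-cong ≈-refl (&-comm φ (⋀ Γ)) ⟩
  ¬ᶠ φ & (⋀ Γ & φ)       ≈⟨ &-cong ≈-refl (⋀-∷ʳ Γ φ) ⟨
  ¬ᶠ φ & ⋀ (Γ ++ [ φ ])  ≲⟨ &-monoʳ (sound d) ⟩
  ¬ᶠ φ & (ψ & ⋀ Δ)       ≈⟨ &-assoc (¬ᶠ φ) ψ (⋀ Δ) ⟨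
  (¬ᶠ φ & ψ) & ⋀ Δ       ≈⟨ &-cong ⇒≈¬& ≈-refl ⟨
  (φ ⇒ᶠ ψ) & ⋀ Δ         ∎
sound (box n {Γ} {φ} d) = begin
  ⋀ (map □_ Γ)           ≲⟨ ⋀-□ Γ ⟩
  □ ⋀ Γ                  ≲⟨ □-mono (sound d) ⟩
  □ ⋀ (replicate n φ)    ≡⟨ cong □_ (⋀-replicate n φ) ⟩
  □ times n φ            ≲⟨ □-times n ⟩
  times n (□ φ)          ≡⟨ ⋀-replicate n (□ φ) ⟨
  ⋀ (replicate n (□ φ))  ∎

permˡ : Γ ↭ Γ' → GK Γ Δ → GK Γ' Δ
permˡ p = perm p ↭-refl

permʳ : Δ ↭ Δ' → GK Γ Δ → GK Γ Δ'
permʳ p = perm ↭-refl p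

𝟘-right : GK [] [ 𝟘 ]
𝟘-right = →R {[]} (ID [ p₀ ])

𝟘-left : GK [ 𝟘 ] []
𝟘-left = →L {[]} (ID [ p₀ ])

-- Cutting against φ → φ removes one occurrence of φ from each side.
cancel : GK (Γ ++ [ φ ]) (φ ∷ Δ) → GK Γ Δ
cancel {Γ} {φ} {Δ} d =
  permʳ (↭-reflexive (++-identityʳ Δ)) (cut {[]} {[]} (→L {[]} (ID [ φ ])) (→R {Γ} d))

cancel-++ : ∀ Θ {Γ Δ} → GK (Θ ++ Γ) (Θ ++ Δ) → GK Γ Δ
cancel-++ [] d = d
cancel-++ (φ ∷ Θ) {Γ} d = cancel-++ Θ (cancel (permˡ (∷↭∷ʳ φ (Θ ++ Γ)) d))

GK-trans : GK Γ Θ → GK Θ Δ → GK Γ Δ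
GK-trans {Γ} {Θ} {Δ} d e = cancel-++ Θ (perm (++-comm Γ Θ) (++-comm Δ Θ) (mix d e))

&-right : ∀ φ ψ → GK (φ ∷ ψ ∷ []) [ φ & ψ ]
&-right φ ψ = →R {φ ∷ ψ ∷ []} (→L {φ ∷ ψ ∷ []} (mix (ID (φ ∷ ψ ∷ [])) 𝟘-left))

&-left : ∀ φ ψ → GK [ φ & ψ ] (φ ∷ ψ ∷ [])
&-left φ ψ =
  →L {[]} (→R {[ ψ ]} (permʳ (prep 𝟘 (swap ψ φ refl)) (mix (ID (ψ ∷ φ ∷ [])) 𝟘-right)))

⋀-right : ∀ Γ → GK Γ [ ⋀ Γ ]
⋀-right [] = 𝟘-right
⋀-right (φ ∷ Γ) = cut {[ φ ]} {Σ = []} (&-right φ (⋀ Γ)) (⋀-right Γ)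

⋀-left : ∀ Δ → GK [ ⋀ Δ ] Δ
⋀-left [] = 𝟘-left
⋀-left (φ ∷ Δ) = cut {[]} {Σ = [ φ ]} (⋀-left Δ) (permʳ (swap φ (⋀ Δ) refl) (&-left φ (⋀ Δ)))

times-right : ∀ n φ → GK (replicate n φ) [ times n φ ]
times-right n φ = subst (λ χ → GK (replicate n φ) [ χ ]) (⋀-replicate n φ) (⋀-right (replicate n φ))

times-left : ∀ n φ → GK [ times n φ ] (replicate n φ)
times-left n φ = subst (λ χ → GK [ χ ] (replicate n φ)) (⋀-replicate n φ) (⋀-left (replicate n φ))

⇒-inversion : GK [] [ φ ⇒ᶠ ψ ] → GK [ φ ] [ ψ ]
⇒-inversion {φ} {ψ} d = cut {[ φ ]} {[ ψ ]} {[]} {[]} (→L {[ φ ]} (ID (φ ∷ ψ ∷ []))) d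

copies-[] : ∀ n → copies n [] ≡ []
copies-[] zero = ≡-refl
copies-[] (suc n) = copies-[] n

copies-[_] : ∀ φ n → copies n [ φ ] ≡ replicate n φ
copies-[ φ ] zero = ≡-refl
copies-[ φ ] (suc n) = cong (φ ∷_) (copies-[ φ ] n)

⊢K⇒GK : ⊢K φ → GK [] [ φ ]
⊢K⇒GK (axB φ ψ χ) = →R {[]} (→R {[ φ ⇒ᶠ ψ ]} (→R {(φ ⇒ᶠ ψ) ∷ (ψ ⇒ᶠ χ) ∷ []}
  (permˡ (↭-sym (∷↭∷ʳ (φ ⇒ᶠ ψ) ((ψ ⇒ᶠ χ) ∷ φ ∷ [])))
   (→L {(ψ ⇒ᶠ χ) ∷ φ ∷ []}
    (permˡ (↭-sym (∷↭∷ʳ (ψ ⇒ᶠ χ) (φ ∷ ψ ∷ [])))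
     (→L {φ ∷ ψ ∷ []} (permʳ (swap φ ψ refl) (ID (φ ∷ ψ ∷ χ ∷ [])))))))))
⊢K⇒GK (axC φ ψ χ) = →R {[]} (→R {[ φ ⇒ᶠ (ψ ⇒ᶠ χ) ]} (→R {(φ ⇒ᶠ (ψ ⇒ᶠ χ)) ∷ ψ ∷ []}
  (permˡ (↭-sym (∷↭∷ʳ (φ ⇒ᶠ (ψ ⇒ᶠ χ)) (ψ ∷ φ ∷ [])))
   (→L {ψ ∷ φ ∷ []} (→L {ψ ∷ φ ∷ []} (ID (ψ ∷ φ ∷ χ ∷ [])))))))
⊢K⇒GK (axI φ) = →R {[]} (ID [ φ ])
⊢K⇒GK (axA φ ψ) = →R {[]} (→L {[]} (→R {[ ψ ]} (ID (ψ ∷ φ ∷ []))))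
⊢K⇒GK (axK φ ψ) = →R {[]} (→R {[ □ (φ ⇒ᶠ ψ) ]}
  (box 1 (permˡ (swap φ (φ ⇒ᶠ ψ) refl) (→L {[ φ ]} (ID (φ ∷ ψ ∷ []))))))
⊢K⇒GK (axD n φ _) = →R {[]} (GK-trans (box n (times-left n φ)) (times-right n (□ φ)))
⊢K⇒GK (mp d e) = GK-trans (⊢K⇒GK d) (⇒-inversion (⊢K⇒GK e))
⊢K⇒GK (nec d) = box 1 {[]} (⊢K⇒GK d)
⊢K⇒GK (con n {φ} n≥2 d) =
  sc n n≥2 (subst₂ GK (sym (copies-[] n)) (sym (copies-[ φ ] n)) (GK-trans (⊢K⇒GK d) (times-left n φ)))

complete : ⋀ Γ ≼ ⋀ Δ → GK Γ Δ
complete {Γ} {Δ} p = GK-trans (⋀-right Γ) (GK-trans (⇒-inversion (⊢K⇒GK p)) (⋀-left Δ))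

proposition4p3 : (Γ Δ : List Formula) → GK Γ Δ ⇔ ⊢K (ℐ Γ Δ)
proposition4p3 Γ Δ = mk⇔
  (λ d → ≼-resp-≈ (≈-sym (bigAnd≈⋀ Γ)) (≈-sym (bigAnd≈⋀ Δ)) (sound d))
  (λ p → complete (≼-resp-≈ (bigAnd≈⋀ Γ) (bigAnd≈⋀ Δ) p))
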